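{- Let $E$ be a finite nonempty set, $X\in\mathcal{X}(2)\setminus\mathcal{X}^*(2)$, and let $f:2^E\to\mathbb{N}$ and $S,T\subseteq E$ satisfy: $X=\mathbb{B}_f(2)$; for every $U\subseteq E$ there is $\mathbf{x}\in\mathbb{B}_f(2)$ with $x(U)=f(U)$; $f(S)=f(T)=f(S\cap T)=1$ and $f(S\cup T)=2$. Then every $\mathbf{x}\in\mathbb{B}_f(2)$ with $\operatorname{supp}(\mathbf{x})\subseteq S\cup T$ satisfies $\operatorname{supp}(\mathbf{x})\cap(S\cap T)=\emptyset$.
   Context: $x(U)=\sum_{e\in U}x_e$; $\operatorname{supp}(\mathbf{x})=\{e: x_e\neq0\}$. $\mathbb{B}_f(d)=\{\mathbf{x}\in\mathbb{N}^E: x(U)\le f(U)\ \forall U\subseteq E,\ x(E)=d\}$. $f$ is strictly positive if $f(U)>0$ for nonempty $U$, normalized if $f(\emptyset)=0$, monotone if $U\subseteq V\Rightarrow f(U)\le f(V)$. $\mathcal{X}(d)$ is the set of all $\mathbb{B}_f(d)$ with $f$ strictly positive, normalized and monotone; $\mathcal{X}^*(d)$ those with $f$ additionally submodular. -}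

module Defs where

open import Data.Nat using (ℕ; zero; suc; _+_; _≤_; _<_; _≡ᵇ_)
open import Data.Bool using (if_then_else_)
open import Data.Fin using (Fin; zero; suc)
open import Data.Fin.Subset using (Subset; Side; inside; outside; _⊆_; ⊤; ⊥; _∈_)
open import Data.Vec using (Vec; []; _∷_; tabulate)
open import Data.Product using (Σ; _×_; ∃)
open import Function using (_∘_; _⇔_)
open import Relation.Binary.PropositionalEquality using (_≡_)
open import Relation.Nullary using (¬_)

xsum : ∀ {n} → Subset n → (Fin n → ℕ) → ℕ
xsum [] x = 0
xsum (inside ∷ U) x = x zero + xsum U (x ∘ suc)
xsum (outside ∷ U) x = xsum U (x ∘ suc)

supp : ∀ {n} → (Fin n → ℕ) → Subset n
supp x = tabulate (λ i → if x i ≡ᵇ 0 then outside else inside)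

InB : ∀ {n} → (Subset n → ℕ) → ℕ → (Fin n → ℕ) → Set
InB {n} f d x = (∀ (U : Subset n) → xsum U x ≤ f U) × xsum ⊤ x ≡ d

StrictlyPositive : ∀ {n} → (Subset n → ℕ) → Set
StrictlyPositive {n} f = ∀ (U : Subset n) → ¬ (U ≡ ⊥) → 0 < f U

Normalized : ∀ {n} → (Subset n → ℕ) → Set
Normalized f = f ⊥ ≡ 0

Monotone : ∀ {n} → (Subset n → ℕ) → Set
Monotone {n} f = ∀ (U V : Subset n) → U ⊆ V → f U ≤ f V

Submodular : ∀ {n} → (Subset n → ℕ) → Set
Submodular {n} f = ∀ (U V : Subset n) →
  f (U Data.Fin.Subset.∪ V) + f (U Data.Fin.Subset.∩ V) ≤ f U + f V

IsBOf : ∀ {n} → ((Fin n → ℕ) → Set) → ℕ → (Subset n → ℕ) → Set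
IsBOf X d g = ∀ x → X x ⇔ InB g d x

InClass : ∀ {n} → ℕ → ((Fin n → ℕ) → Set) → Set
InClass {n} d X = Σ (Subset n → ℕ) λ g →
  StrictlyPositive g × Normalized g × Monotone g × IsBOf X d g

InClassSub : ∀ {n} → ℕ → ((Fin n → ℕ) → Set) → Set
InClassSub {n} d X = Σ (Subset n → ℕ) λ g →
  StrictlyPositive g × Normalized g × Monotone g × Submodular g × IsBOf X d g

-- For x supported in S ∪ T, inclusion–exclusion gives x(E) + x(S ∩ T) = x(S) + x(T).
-- Since x(E) = 2 and x(S), x(T) ≤ 1, this forces x(S ∩ T) = 0, i.e. x vanishes on S ∩ T.
-- Only f(S) = f(T) = 1 is needed.
module Submission where

open import Defs
open import Data.Nat using (ℕ; zero; suc; _+_; _≤_)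
open import Data.Nat.Properties
  using (+-assoc; +-commutativeSemigroup; +-mono-≤; +-cancelˡ-≤; m+n≡0⇒m≡0; m+n≡0⇒n≡0; n≤0⇒n≡0; module ≤-Reasoning)
open import Algebra.Properties.CommutativeSemigroup +-commutativeSemigroup using (interchange; x∙yz≈y∙xz)
open import Data.Fin using (Fin; zero; suc)
open import Data.Fin.Subset using (Subset; _⊆_; _∪_; _∩_; ⊥; ⊤; inside; outside)
open import Data.Fin.Subset.Properties using (drop-∷-⊆)
open import Data.Vec using ([]; _∷_; here)
open import Data.Product using (Σ; _×_; _,_)
open import Function using (_∘_)
open import Relation.Binary.PropositionalEquality using (_≡_; refl; sym; trans; cong; subst; module ≡-Reasoning)
open import Relation.Nullary using (¬_)

xsum-∪+∩ : ∀ {n} (U V : Subset n) (x : Fin n → ℕ) →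
           xsum (U ∪ V) x + xsum (U ∩ V) x ≡ xsum U x + xsum V x
xsum-∪+∩ []           []           x = refl
xsum-∪+∩ (inside ∷ U) (inside ∷ V) x = begin
  (a + xsum (U ∪ V) y) + (a + xsum (U ∩ V) y) ≡⟨ interchange a _ a _ ⟩
  (a + a) + (xsum (U ∪ V) y + xsum (U ∩ V) y) ≡⟨ cong ((a + a) +_) (xsum-∪+∩ U V y) ⟩
  (a + a) + (xsum U y + xsum V y)             ≡⟨ interchange a a _ _ ⟩
  (a + xsum U y) + (a + xsum V y)             ∎
  where open ≡-Reasoning; a = x zero; y = x ∘ suc
xsum-∪+∩ (inside ∷ U) (outside ∷ V) x = begin
  (a + xsum (U ∪ V) y) + xsum (U ∩ V) y ≡⟨ +-assoc a _ _ ⟩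
  a + (xsum (U ∪ V) y + xsum (U ∩ V) y) ≡⟨ cong (a +_) (xsum-∪+∩ U V y) ⟩
  a + (xsum U y + xsum V y)             ≡⟨ +-assoc a _ _ ⟨
  (a + xsum U y) + xsum V y             ∎
  where open ≡-Reasoning; a = x zero; y = x ∘ suc
xsum-∪+∩ (outside ∷ U) (inside ∷ V) x = begin
  (a + xsum (U ∪ V) y) + xsum (U ∩ V) y ≡⟨ +-assoc a _ _ ⟩
  a + (xsum (U ∪ V) y + xsum (U ∩ V) y) ≡⟨ cong (a +_) (xsum-∪+∩ U V y) ⟩
  a + (xsum U y + xsum V y)             ≡⟨ x∙yz≈y∙xz a (xsum U y) (xsum V y) ⟩
  xsum U y + (a + xsum V y)             ∎
  where open ≡-Reasoning; a = x zero; y = x ∘ suc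
xsum-∪+∩ (outside ∷ U) (outside ∷ V) x = xsum-∪+∩ U V (x ∘ suc)

supp-⊆-outside⇒head≡0 : ∀ {n} (x : Fin (suc n) → ℕ) {U : Subset n} →
                        supp x ⊆ outside ∷ U → x zero ≡ 0
supp-⊆-outside⇒head≡0 x h with x zero
... | zero  = refl
... | suc _ with () ← h here

supp-⊆⇒xsum-⊤≡xsum : ∀ {n} (U : Subset n) (x : Fin n → ℕ) → supp x ⊆ U → xsum ⊤ x ≡ xsum U x
supp-⊆⇒xsum-⊤≡xsum []            x h = refl
supp-⊆⇒xsum-⊤≡xsum (inside ∷ U)  x h =
  cong (x zero +_) (supp-⊆⇒xsum-⊤≡xsum U (x ∘ suc) (drop-∷-⊆ h))
supp-⊆⇒xsum-⊤≡xsum (outside ∷ U) x h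
  rewrite supp-⊆-outside⇒head≡0 x h = supp-⊆⇒xsum-⊤≡xsum U (x ∘ suc) (drop-∷-⊆ h)

xsum≡0⇒supp∩≡⊥ : ∀ {n} (V : Subset n) (x : Fin n → ℕ) → xsum V x ≡ 0 → supp x ∩ V ≡ ⊥
xsum≡0⇒supp∩≡⊥ []            x e = refl
xsum≡0⇒supp∩≡⊥ (inside ∷ V)  x e
  rewrite m+n≡0⇒m≡0 (x zero) e = cong (outside ∷_) (xsum≡0⇒supp∩≡⊥ V (x ∘ suc) (m+n≡0⇒n≡0 (x zero) e))
xsum≡0⇒supp∩≡⊥ (outside ∷ V) x e with x zero
... | zero  = cong (outside ∷_) (xsum≡0⇒supp∩≡⊥ V (x ∘ suc) e)
... | suc _ = cong (outside ∷_) (xsum≡0⇒supp∩≡⊥ V (x ∘ suc) e)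

lemma6p2 : (n : ℕ) → 1 ≤ n →
    (X : (Fin n → ℕ) → Set) → InClass 2 X → ¬ InClassSub 2 X →
    (f : Subset n → ℕ) → (S T : Subset n) →
    IsBOf X 2 f →
    (∀ (U : Subset n) → Σ (Fin n → ℕ) λ x → InB f 2 x × xsum U x ≡ f U) →
    f S ≡ 1 → f T ≡ 1 → f (S ∩ T) ≡ 1 → f (S ∪ T) ≡ 2 →
    ∀ (x : Fin n → ℕ) → InB f 2 x → supp x ⊆ S ∪ T →
    supp x ∩ (S ∩ T) ≡ ⊥
lemma6p2 n _ X _ _ f S T _ _ fS≡1 fT≡1 _ _ x (x≤f , x[E]≡2) supp⊆S∪T =
  xsum≡0⇒supp∩≡⊥ (S ∩ T) x (n≤0⇒n≡0 (+-cancelˡ-≤ 2 _ 0 2+x[S∩T]≤2))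
  where
  x[S∪T]≡2 : xsum (S ∪ T) x ≡ 2
  x[S∪T]≡2 = trans (sym (supp-⊆⇒xsum-⊤≡xsum (S ∪ T) x supp⊆S∪T)) x[E]≡2

  2+x[S∩T]≤2 : 2 + xsum (S ∩ T) x ≤ 2
  2+x[S∩T]≤2 = begin
    2 + xsum (S ∩ T) x              ≡⟨ cong (_+ xsum (S ∩ T) x) x[S∪T]≡2 ⟨
    xsum (S ∪ T) x + xsum (S ∩ T) x ≡⟨ xsum-∪+∩ S T x ⟩
    xsum S x + xsum T x             ≤⟨ +-mono-≤ (subst (xsum S x ≤_) fS≡1 (x≤f S))
                                                (subst (xsum T x ≤_) fT≡1 (x≤f T)) ⟩
    2                               ∎
    where open ≤-Reasoning
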